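{- Let $\ell \geq 1$ be an integer and let $G$ be a graph of order $n$. Suppose that $V(G)$ is partitioned into $V_1$ and $V_2$, where $V_1$ is nonempty and $V_2$ is possibly empty, such that every vertex in $V_1$ has degree at least $\frac{n}{2}+2\ell-1$ in $G$ and every vertex in $V_2$ has degree at least $|V_2|+2\ell$ in $G$. Then for any multiset $\{ \{u_1,v_1\}, \{u_2,v_2\}, \ldots, \{u_\ell,v_\ell \} \}$ of $\ell$ pairs of vertices of $G$ (the same pair may occur more than once), there are $\ell$ pairwise edge-disjoint Hamiltonian paths $P_1,P_2,\ldots,P_\ell$ in $G$ such that $P_i$ connects $u_i$ and $v_i$ for each $1 \leq i \leq \ell$.
   Context: All graphs are finite, simple and undirected. A pair of vertices means two distinct vertices. A Hamiltonian path connecting $u$ and $v$ is a path through all vertices of $G$ with end vertices $u$ and $v$. -}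

module Defs where

open import Data.Nat using (ℕ; suc; _+_; _*_; _≤_)
open import Data.Fin using (Fin)
open import Data.Bool using (Bool; true; false; T; not)
open import Data.List using (List; []; _∷_; length; filterᵇ; head; last; allFin)
open import Data.List.Membership.Propositional using (_∈_)
open import Data.List.Relation.Unary.Unique.Propositional using (Unique)
open import Data.List.Relation.Unary.Linked using (Linked)
open import Data.Maybe using (just)
open import Data.Product using (Σ; _×_)
open import Relation.Binary.PropositionalEquality using (_≡_)
open import Relation.Nullary using (¬_)

record Graph (n : ℕ) : Set where
  field
    adj   : Fin n → Fin n → Bool
    sym   : ∀ x y → adj x y ≡ adj y x
    irref : ∀ x → adj x x ≡ false
open Graph public

Adj : ∀ {n} → Graph n → Fin n → Fin n → Set
Adj G x y = T (adj G x y)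

countV : ∀ {n} → (Fin n → Bool) → ℕ
countV {n} p = length (filterᵇ p (allFin n))

degree : ∀ {n} → Graph n → Fin n → ℕ
degree G x = countV (adj G x)

record HamPath {n : ℕ} (G : Graph n) (u v : Fin n) : Set where
  field
    verts   : List (Fin n)
    unique  : Unique verts
    covers  : ∀ x → x ∈ verts
    linked  : Linked (Adj G) verts
    start   : head verts ≡ just u
    end     : last verts ≡ just v
open HamPath public

data EdgeIn {n : ℕ} : List (Fin n) → Fin n → Fin n → Set where
  here-fwd : ∀ {x y xs} → EdgeIn (x ∷ y ∷ xs) x y
  here-bwd : ∀ {x y xs} → EdgeIn (x ∷ y ∷ xs) y x
  there    : ∀ {x xs a b} → EdgeIn xs a b → EdgeIn (x ∷ xs) a b

EdgeDisjoint : ∀ {n} {G : Graph n} {u v u' v' : Fin n} →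
               HamPath G u v → HamPath G u' v' → Set
EdgeDisjoint P Q = ∀ a b → EdgeIn (verts P) a b → ¬ EdgeIn (verts Q) a b

module Submission where

-- Deleting the edges of a Hamiltonian path lowers every degree by at most 2, which
-- turns the degree condition for ℓ into the one for ℓ − 1. So the paths can be chosen
-- greedily, and it suffices that the condition for ℓ = 1 makes G Hamilton-connected.
-- For this we use the Bondy–Chvátal closure: if x y is a non-edge with
-- deg x + deg y ≥ n + 1, a Pósa rotation turns every Hamiltonian path of G + x y into
-- one of G with the same ends. While G is not complete the degree condition provides
-- such a pair: two non-adjacent vertices of V₁, or a vertex adjacent to all of V₁
-- together with a non-neighbour in V₂.

open import Defs hiding (sym)
open import Data.Fin using (Fin; zero; suc; _≟_)
open import Data.Fin.Properties using (any?)
open import Data.Nat using (ℕ; zero; suc; _+_; _*_; _≤_; _<_; z≤n; s≤s)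
open import Data.Nat.Properties hiding (_≟_)
open import Data.Nat.Induction using (<-wellFounded)
open import Induction.WellFounded using (Acc; acc)
open import Data.Nat.Tactic.RingSolver using (solve-∀)
open import Algebra.Properties.CommutativeSemigroup +-commutativeSemigroup using (interchange)
open import Data.Bool using (Bool; true; false; T; not; _∧_; _∨_; if_then_else_)
open import Data.Bool.Properties using (T-≡; T-∧; T-∨; T-not-≡; ¬-not) renaming (_≟_ to _≟ᵇ_)
open import Function using (id; _∘_)
open import Function.Bundles using (Equivalence; mk⇔)
open import Data.Unit using (tt)
open import Data.Empty using (⊥-elim)
open import Data.Product using (Σ; ∃; _×_; _,_; proj₁; proj₂; uncurry)
open import Data.Sum using (_⊎_; inj₁; inj₂)
import Data.Sum as Sum
open import Data.Maybe using (Maybe; just)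
open import Data.Maybe.Relation.Binary.Connected using (Connected; just)
open import Data.List using (List; allFin; cartesianProduct; []; _∷_; _++_; [_]; length; head; last; reverse; filter; filterᵇ)
open import Data.List.Properties using (++-assoc; length-++; filter-++; length-filter; filter-notAll; unfold-reverse; reverse-involutive; reverse-++; length-tabulate)
open import Data.List.Membership.Propositional using (_∈_; _∉_)
open import Data.List.Membership.Propositional.Properties using (∈-filter⁺; ∈-filter⁻; ∈-allFin; ∈-++⁺ˡ; ∈-++⁺ʳ; ∈-++⁻; ∈-cartesianProduct⁺)
open import Data.List.Relation.Unary.Any using (here; there)
import Data.List.Relation.Unary.Any as Any
open import Data.List.Relation.Unary.All as All using (All)
open import Data.List.Relation.Unary.AllPairs using ([]; _∷_)
open import Data.List.Relation.Unary.Unique.Propositional using (Unique)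
open import Data.List.Relation.Unary.Unique.Propositional.Properties using (allFin⁺; ++⁺; Unique[x∷xs]⇒x∉xs) renaming (filter⁺ to Unique-filter⁺)
open import Data.List.Relation.Unary.Linked as Linked using (Linked; []; [-]; _∷_)
open import Data.List.Relation.Unary.Linked.Properties using (AllPairs⇒Linked) renaming (++⁺ to Linked-++⁺)
open import Data.List.Relation.Binary.Subset.Propositional using (_⊆_)
open import Data.List.Relation.Binary.Permutation.Propositional using (_↭_; ↭-refl; ↭-sym; ↭-trans; ↭-reflexive; prep; ↭⇒↭ₛ)
open import Data.List.Relation.Binary.Permutation.Propositional.Properties using (↭-length; filter-↭; ↭-reverse; ++⁺ˡ; ++⁺ʳ; shift; ∈-resp-↭)
open import Data.List.Relation.Binary.Permutation.Setoid.Properties using (Unique-resp-↭)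
open import Relation.Binary.Definitions using (DecidableEquality)
open import Relation.Binary.Construct.Union using (_∪_)
open import Relation.Binary.PropositionalEquality hiding ([_])
open import Relation.Nullary using (¬_; Dec; yes; no; does)
open import Relation.Nullary.Decidable using (¬?; T?; _×-dec_; _⊎-dec_; map′; isYes; isYes≗does; does-⇔; toWitness; fromWitness; toWitnessFalse; fromWitnessFalse)

module _ {A : Set} where

  count : (A → Bool) → List A → ℕ
  count p xs = length (filterᵇ p xs)

  count≤length : ∀ p xs → count p xs ≤ length xs
  count≤length p = length-filter (λ x → T? (p x))

  count-++ : ∀ p xs ys → count p (xs ++ ys) ≡ count p xs + count p ys
  count-++ p xs ys = trans (cong length (filter-++ (λ x → T? (p x)) xs ys)) (length-++ (filterᵇ p xs))

  count-↭ : ∀ p {xs ys} → xs ↭ ys → count p xs ≡ count p ys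
  count-↭ p xs↭ys = ↭-length (filter-↭ (λ x → T? (p x)) xs↭ys)

  count-mono : ∀ {p q} → (∀ x → T (p x) → T (q x)) → ∀ xs → count p xs ≤ count q xs
  count-mono p⇒q [] = z≤n
  count-mono {p} {q} p⇒q (x ∷ xs) with p x | q x | p⇒q x
  ... | true  | true  | _ = s≤s (count-mono p⇒q xs)
  ... | true  | false | f = ⊥-elim (f tt)
  ... | false | true  | _ = m≤n⇒m≤1+n (count-mono p⇒q xs)
  ... | false | false | _ = count-mono p⇒q xs

  count-mono-< : ∀ {p q} → (∀ x → T (p x) → T (q x)) →
                 ∀ {y xs} → y ∈ xs → T (q y) → ¬ T (p y) → count p xs < count q xs
  count-mono-< {p} {q} p⇒q {xs = x ∷ xs} (here refl) qx ¬px with p x | q x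
  ... | true  | _     = ⊥-elim (¬px tt)
  ... | false | true  = s≤s (count-mono p⇒q xs)
  ... | false | false = ⊥-elim qx
  count-mono-< {p} {q} p⇒q {xs = x ∷ xs} (there y∈xs) qy ¬py with p x | q x | p⇒q x
  ... | true  | true  | _ = s≤s (count-mono-< p⇒q y∈xs qy ¬py)
  ... | true  | false | f = ⊥-elim (f tt)
  ... | false | true  | _ = m<n⇒m<1+n (count-mono-< p⇒q y∈xs qy ¬py)
  ... | false | false | _ = count-mono-< p⇒q y∈xs qy ¬py

  count-∨ : ∀ p q xs → count (λ x → p x ∨ q x) xs ≤ count p xs + count q xs
  count-∨ p q [] = z≤n
  count-∨ p q (x ∷ xs) with p x | q x
  ... | true  | true  = s≤s (≤-trans (count-∨ p q xs) (+-monoʳ-≤ (count p xs) (n≤1+n _)))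
  ... | true  | false = s≤s (count-∨ p q xs)
  ... | false | true  = ≤-trans (s≤s (count-∨ p q xs)) (≤-reflexive (sym (+-suc _ _)))
  ... | false | false = count-∨ p q xs

  count-partition : ∀ p xs → count p xs + count (λ x → not (p x)) xs ≡ length xs
  count-partition p [] = refl
  count-partition p (x ∷ xs) with p x
  ... | true  = cong suc (count-partition p xs)
  ... | false = trans (+-suc _ _) (cong suc (count-partition p xs))

  count-reject : ∀ p {x} xs → p x ≡ false → count p (x ∷ xs) ≡ count p xs
  count-reject p {x} xs px with p x
  count-reject p xs refl | false = refl

module _ {A : Set} (_≟_ : DecidableEquality A) where

  length-mono-⊆ : ∀ {xs ys : List A} → Unique xs → xs ⊆ ys → length xs ≤ length ys
  length-mono-⊆ [] _ = z≤n
  length-mono-⊆ {x ∷ xs} {ys} (x∉xs ∷ u) xs⊆ys = begin-strict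
    length xs              ≤⟨ length-mono-⊆ u xs⊆rest ⟩
    length (filter x≢? ys) <⟨ filter-notAll x≢? ys (Any.map (λ x≡y x≢y → x≢y x≡y) (xs⊆ys (here refl))) ⟩
    length ys              ∎
    where
    open ≤-Reasoning
    x≢? : ∀ y → Dec (x ≢ y)
    x≢? y = ¬? (x ≟ y)
    xs⊆rest : xs ⊆ filter x≢? ys
    xs⊆rest z∈xs = ∈-filter⁺ x≢? (xs⊆ys (there z∈xs)) (All.lookup x∉xs z∈xs)

  count-mono-⊆ : ∀ p {xs ys} → Unique xs → (∀ {x} → x ∈ xs → T (p x) → x ∈ ys) →
                 count p xs ≤ count p ys
  count-mono-⊆ p u sub = length-mono-⊆ (Unique-filter⁺ (λ x → T? (p x)) u) λ m →
    let m′ , px = ∈-filter⁻ (λ x → T? (p x)) m in ∈-filter⁺ (λ x → T? (p x)) (sub m′ px) px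

module _ {A : Set} where

  last-++-∷ : ∀ xs (y : A) ys → last (xs ++ y ∷ ys) ≡ last (y ∷ ys)
  last-++-∷ []           y ys = refl
  last-++-∷ (x ∷ [])     y ys = refl
  last-++-∷ (x ∷ x′ ∷ xs) y ys = last-++-∷ (x′ ∷ xs) y ys

  head-++ : ∀ {x : A} xs ys → head xs ≡ just x → head (xs ++ ys) ≡ just x
  head-++ (x ∷ xs) ys hd = hd

  head-++-∷ : ∀ xs (y : A) ys zs → head (xs ++ y ∷ ys) ≡ head (xs ++ y ∷ zs)
  head-++-∷ []       y ys zs = refl
  head-++-∷ (x ∷ xs) y ys zs = refl

  last-reverse : ∀ (xs : List A) → last (reverse xs) ≡ head xs
  last-reverse []       = refl
  last-reverse (x ∷ xs) = trans (cong last (unfold-reverse x xs)) (last-++-∷ (reverse xs) x [])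

  head-reverse : ∀ (xs : List A) → head (reverse xs) ≡ last xs
  head-reverse xs = trans (sym (last-reverse (reverse xs))) (cong last (reverse-involutive xs))

  connected : ∀ {R : A → A → Set} {m k : Maybe A} {x y} → m ≡ just x → k ≡ just y → R x y → Connected R m k
  connected refl refl r = just r

  module _ {R : A → A → Set} (R-sym : ∀ {x y} → R x y → R y x) where

    Linked-reverse : ∀ {xs} → Linked R xs → Linked R (reverse xs)
    Linked-reverse [] = []
    Linked-reverse [-] = [-]
    Linked-reverse {x ∷ y ∷ xs} (r ∷ l) = subst (Linked R) (sym (unfold-reverse x (y ∷ xs)))
      (Linked-++⁺ (Linked-reverse l) (connected (last-reverse (y ∷ xs)) refl (R-sym r)) [-])

  module _ {R : A → A → Set} where

    Linked-++⁻ˡ : ∀ xs {ys} → Linked R (xs ++ ys) → Linked R xs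
    Linked-++⁻ˡ []           l       = []
    Linked-++⁻ˡ (x ∷ [])     l       = [-]
    Linked-++⁻ˡ (x ∷ y ∷ xs) (r ∷ l) = r ∷ Linked-++⁻ˡ (y ∷ xs) l

    Linked-++⁻ʳ : ∀ xs {ys} → Linked R (xs ++ ys) → Linked R ys
    Linked-++⁻ʳ []       l = l
    Linked-++⁻ʳ (x ∷ xs) l = Linked-++⁻ʳ xs (Linked.tail l)

  data Crossing (p q : A → Bool) : List A → Set where
    here  : ∀ {x y xs} → T (p x) → T (q y) → Crossing p q (x ∷ y ∷ xs)
    there : ∀ {x xs} → Crossing p q xs → Crossing p q (x ∷ xs)

  crossing? : ∀ p q xs → Dec (Crossing p q xs)
  crossing? p q [] = no λ ()
  crossing? p q (x ∷ []) = no λ { (there ()) }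
  crossing? p q (x ∷ y ∷ xs) with T? (p x) ×-dec T? (q y) | crossing? p q (y ∷ xs)
  ... | yes (px , qy) | _     = yes (here px qy)
  ... | no _          | yes c = yes (there c)
  ... | no ¬pq        | no ¬c = no λ { (here px qy) → ¬pq (px , qy) ; (there c) → ¬c c }

  crossing-split : ∀ {p q xs} → Crossing p q xs →
                   ∃ λ γ → ∃ λ x → ∃ λ y → ∃ λ δ → xs ≡ γ ++ x ∷ y ∷ δ × T (p x) × T (q y)
  crossing-split (here {x} {y} {xs} px qy) = [] , x , y , xs , refl , px , qy
  crossing-split (there {x} c) with crossing-split c
  ... | γ , a , b , δ , refl , pa , qb = x ∷ γ , a , b , δ , refl , pa , qb

  -- Without a crossing, every q-entry of xs is preceded by an entry that is not a p-entry.
  crossing-free-count : ∀ p q x xs → ¬ Crossing p q (x ∷ xs) → count p (x ∷ xs) + count q xs ≤ length (x ∷ xs)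
  crossing-free-count p q x [] _ = ≤-trans (≤-reflexive (+-identityʳ _)) (count≤length p (x ∷ []))
  crossing-free-count p q x (y ∷ ys) ¬c with p x in px | q y in qy | crossing-free-count p q y ys (λ c → ¬c (there c))
  ... | true  | true  | _  = ⊥-elim (¬c (here (Equivalence.from T-≡ px) (Equivalence.from T-≡ qy)))
  ... | true  | false | ih = s≤s ih
  ... | false | true  | ih = ≤-trans (≤-reflexive (+-suc _ _)) (s≤s ih)
  ... | false | false | ih = m≤n⇒m≤1+n ih

-- Rerouting a Hamiltonian path

module _ {n : ℕ} (H : Graph n) where

  Adj-sym : ∀ {x y} → Adj H x y → Adj H y x
  Adj-sym {x} {y} = subst T (Graph.sym H x y)

  Rerouting : List (Fin n) → Set
  Rerouting L = Σ (List (Fin n)) λ L′ →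
    L′ ↭ L × Linked (Adj H) L′ × head L′ ≡ head L × last L′ ≡ last L

  Rerouting-reverse : ∀ {L} → Rerouting (reverse L) → Rerouting L
  Rerouting-reverse {L} (L′ , L′↭ , path , hd , ls) =
    reverse L′ ,
    ↭-trans (↭-reverse L′) (↭-trans L′↭ (↭-reverse L)) ,
    Linked-reverse Adj-sym path ,
    trans (head-reverse L′) (trans ls (last-reverse L)) ,
    trans (last-reverse L′) (trans hd (head-reverse L))

  Rerouting⇒HamPath : ∀ {L u v} → Unique L → (∀ z → z ∈ L) → head L ≡ just u → last L ≡ just v →
                      Rerouting L → HamPath H u v
  Rerouting⇒HamPath uniq cov hd ls (L′ , L′↭ , path , hd′ , ls′) = record
    { verts  = L′
    ; unique = Unique-resp-↭ (setoid _) (↭⇒↭ₛ (↭-sym L′↭)) uniq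
    ; covers = λ z → ∈-resp-↭ (↭-sym L′↭) (cov z)
    ; linked = path
    ; start  = trans hd′ hd
    ; end    = trans ls′ ls
    }

  -- Pósa rotation: reversing the segment b … x of α a b … x y δ yields α a x … b y δ.
  rotate : ∀ {a b} → adj H a b ≡ false → ∀ α β →
           Linked (Adj H) (α ++ [ a ]) → Linked (Adj H) (b ∷ β) →
           Crossing (adj H a) (adj H b) (b ∷ β) → Rerouting (α ++ a ∷ b ∷ β)
  rotate a≁b α β lα lβ c with crossing-split c
  ... | [] , _ , _ , _ , refl , ab , _ = ⊥-elim (subst T a≁b ab)
  rotate {a} {b} a≁b α β lα lβ c | (.b ∷ γ) , x , y , δ , refl , ax , by =
    α ++ a ∷ K , L′↭ , path , head-++-∷ α a K _ , ends
    where
    M : List (Fin n)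
    M = b ∷ γ ++ [ x ]
    M++ : M ++ y ∷ δ ≡ b ∷ γ ++ x ∷ y ∷ δ
    M++ = cong (b ∷_) (++-assoc γ [ x ] (y ∷ δ))
    K : List (Fin n)
    K = reverse M ++ y ∷ δ
    L′↭ : α ++ a ∷ K ↭ α ++ a ∷ b ∷ γ ++ x ∷ y ∷ δ
    L′↭ = ++⁺ˡ α (prep a (↭-trans (++⁺ʳ (y ∷ δ) (↭-reverse M)) (↭-reflexive M++)))
    lMyδ : Linked (Adj H) (M ++ y ∷ δ)
    lMyδ = subst (Linked (Adj H)) (sym M++) lβ
    linkedK : Linked (Adj H) K
    linkedK = Linked-++⁺ (Linked-reverse Adj-sym (Linked-++⁻ˡ M lMyδ))
                         (connected (last-reverse M) refl by) (Linked-++⁻ʳ M lMyδ)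
    head-K : head K ≡ just x
    head-K = head-++ (reverse M) (y ∷ δ) (trans (head-reverse M) (last-++-∷ (b ∷ γ) x []))
    path : Linked (Adj H) (α ++ a ∷ K)
    path = subst (Linked (Adj H)) (++-assoc α [ a ] K)
               (Linked-++⁺ lα (connected (last-++-∷ α a []) head-K ax) linkedK)
    ends : last (α ++ a ∷ K) ≡ last (α ++ a ∷ b ∷ γ ++ x ∷ y ∷ δ)
    ends = trans (last-++-∷ α a K) (trans (last-++-∷ (a ∷ reverse M) y δ)
             (sym (trans (last-++-∷ α a _) (last-++-∷ (a ∷ b ∷ γ) x (y ∷ δ)))))

  degree-sum-bound : ∀ {a b} α β → Unique (α ++ a ∷ b ∷ β) → (∀ z → z ∈ α ++ a ∷ b ∷ β) →
                     ¬ Crossing (adj H a) (adj H b) (b ∷ β) →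
                     ¬ Crossing (adj H b) (adj H a) (a ∷ reverse α) →
                     degree H a + degree H b ≤ n
  degree-sum-bound {a} {b} α β uniq cov ¬cβ ¬cα = begin
    degree H a + degree H b
      ≤⟨ +-mono-≤ (count-mono-⊆ _≟_ pa (allFin⁺ n) (λ {z} _ _ → cov z))
                  (count-mono-⊆ _≟_ pb (allFin⁺ n) (λ {z} _ _ → cov z)) ⟩
    count pa L + count pb L
      ≡⟨ cong₂ _+_ (split pa) (split pb) ⟩
    (count pa A + count pa B) + (count pb A + count pb B)
      ≡⟨ interchange (count pa A) (count pa B) (count pb A) (count pb B) ⟩
    (count pa A + count pb A) + (count pa B + count pb B)
      ≤⟨ +-mono-≤ bound-A bound-B ⟩
    length A + length B
      ≡⟨ sym (length-++ A) ⟩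
    length (A ++ B)
      ≡⟨ ↭-length (↭-sym L↭A++B) ⟩
    length L
      ≤⟨ length-mono-⊆ _≟_ uniq (λ {z} _ → ∈-allFin z) ⟩
    length (allFin n)
      ≡⟨ length-tabulate id ⟩
    n ∎
    where
    open ≤-Reasoning
    pa pb : Fin n → Bool
    pa = adj H a
    pb = adj H b
    L A B : List (Fin n)
    L = α ++ a ∷ b ∷ β
    A = a ∷ reverse α
    B = b ∷ β
    L↭A++B : L ↭ A ++ B
    L↭A++B = ↭-trans (shift a α B) (prep a (++⁺ʳ B (↭-sym (↭-reverse α))))
    split : ∀ p → count p L ≡ count p A + count p B
    split p = trans (count-↭ p L↭A++B) (count-++ p A B)
    bound-A : count pa A + count pb A ≤ length A
    bound-A = begin
      count pa A + count pb A           ≡⟨ cong (_+ count pb A) (count-reject pa (reverse α) (irref H a)) ⟩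
      count pa (reverse α) + count pb A ≡⟨ +-comm _ (count pb A) ⟩
      count pb A + count pa (reverse α) ≤⟨ crossing-free-count pb pa a (reverse α) ¬cα ⟩
      length A                          ∎
    bound-B : count pa B + count pb B ≤ length B
    bound-B = begin
      count pa B + count pb B ≡⟨ cong (count pa B +_) (count-reject pb β (irref H b)) ⟩
      count pa B + count pb β ≤⟨ crossing-free-count pa pb b β ¬cβ ⟩
      length B                ∎

  -- Ore's argument: a rotation applies on one side of a b, or counting contradicts the degree sum.
  reroute : ∀ {a b} → adj H a b ≡ false → n + 1 ≤ degree H a + degree H b → ∀ α β →
            Unique (α ++ a ∷ b ∷ β) → (∀ z → z ∈ α ++ a ∷ b ∷ β) →
            Linked (Adj H) (α ++ [ a ]) → Linked (Adj H) (b ∷ β) → Rerouting (α ++ a ∷ b ∷ β)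
  reroute {a} {b} a≁b deg α β uniq cov lα lβ
    with crossing? (adj H a) (adj H b) (b ∷ β) | crossing? (adj H b) (adj H a) (a ∷ reverse α)
  ... | yes cβ | _      = rotate a≁b α β lα lβ cβ
  ... | no _   | yes cα = Rerouting-reverse (subst Rerouting (sym reverse-L)
                            (rotate (trans (Graph.sym H b a) a≁b) (reverse β) (reverse α) lβ′ lα′ cα))
    where
    reverse-L : reverse (α ++ a ∷ b ∷ β) ≡ reverse β ++ b ∷ a ∷ reverse α
    reverse-L = trans (reverse-++ α (a ∷ b ∷ β))
                  (trans (cong (_++ reverse α) (reverse-++ (a ∷ b ∷ []) β))
                         (++-assoc (reverse β) (b ∷ a ∷ []) (reverse α)))
    lβ′ : Linked (Adj H) (reverse β ++ [ b ])
    lβ′ = subst (Linked (Adj H)) (unfold-reverse b β) (Linked-reverse Adj-sym lβ)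
    lα′ : Linked (Adj H) (a ∷ reverse α)
    lα′ = subst (Linked (Adj H)) (reverse-++ α [ a ]) (Linked-reverse Adj-sym lα)
  ... | no ¬cβ | no ¬cα =
    ⊥-elim (1+n≰n (subst (_≤ n) (+-comm n 1) (≤-trans deg (degree-sum-bound α β uniq cov ¬cβ ¬cα))))

module _ {n : ℕ} where

  EdgeIn-sym : ∀ {L : List (Fin n)} {a b} → EdgeIn L a b → EdgeIn L b a
  EdgeIn-sym here-fwd  = here-bwd
  EdgeIn-sym here-bwd  = here-fwd
  EdgeIn-sym (there e) = there (EdgeIn-sym e)

  EdgeIn? : ∀ (L : List (Fin n)) a b → Dec (EdgeIn L a b)
  EdgeIn? []           a b = no λ ()
  EdgeIn? (x ∷ [])     a b = no λ { (there ()) }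
  EdgeIn? (x ∷ y ∷ xs) a b =
    map′ from to ((x ≟ a ×-dec y ≟ b) ⊎-dec (x ≟ b ×-dec y ≟ a) ⊎-dec EdgeIn? (y ∷ xs) a b)
    where
    from : (x ≡ a × y ≡ b) ⊎ (x ≡ b × y ≡ a) ⊎ EdgeIn (y ∷ xs) a b → EdgeIn (x ∷ y ∷ xs) a b
    from (inj₁ (refl , refl))        = here-fwd
    from (inj₂ (inj₁ (refl , refl))) = here-bwd
    from (inj₂ (inj₂ e))             = there e
    to : EdgeIn (x ∷ y ∷ xs) a b → (x ≡ a × y ≡ b) ⊎ (x ≡ b × y ≡ a) ⊎ EdgeIn (y ∷ xs) a b
    to here-fwd  = inj₁ (refl , refl)
    to here-bwd  = inj₂ (inj₁ (refl , refl))
    to (there e) = inj₂ (inj₂ e)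

  onWalk : List (Fin n) → Fin n → Fin n → Bool
  onWalk L a b = isYes (EdgeIn? L a b)

  onWalk-sym : ∀ L a b → onWalk L a b ≡ onWalk L b a
  onWalk-sym L a b = trans (isYes≗does (EdgeIn? L a b))
    (trans (does-⇔ (mk⇔ EdgeIn-sym EdgeIn-sym) (EdgeIn? L a b) (EdgeIn? L b a))
           (sym (isYes≗does (EdgeIn? L b a))))

  Linked-edge : ∀ {R : Fin n → Fin n → Set} → (∀ {x y} → R x y → R y x) →
                ∀ {L a b} → Linked R L → EdgeIn L a b → R a b
  Linked-edge R-sym (r ∷ _) here-fwd  = r
  Linked-edge R-sym (r ∷ _) here-bwd  = R-sym r
  Linked-edge R-sym (_ ∷ l) (there e) = Linked-edge R-sym l e
  Linked-edge R-sym [-]     (there ())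

  neighbours : List (Fin n) → Fin n → List (Fin n)
  neighbours (y ∷ z ∷ zs) x =
    (if does (y ≟ x) then [ z ] else []) ++ (if does (z ≟ x) then [ y ] else []) ++ neighbours (z ∷ zs) x
  neighbours _ _ = []

  EdgeIn⇒∈-neighbours : ∀ {L x w} → EdgeIn L x w → w ∈ neighbours L x
  EdgeIn⇒∈-neighbours (here-fwd {y}) with y ≟ y
  ... | yes _ = here refl
  ... | no y≢y = ⊥-elim (y≢y refl)
  EdgeIn⇒∈-neighbours (here-bwd {y} {z}) with z ≟ z
  ... | yes _ = ∈-++⁺ʳ (if does (y ≟ z) then [ z ] else []) (here refl)
  ... | no z≢z = ⊥-elim (z≢z refl)
  EdgeIn⇒∈-neighbours (there {y} {z ∷ zs} {x} e) =
    ∈-++⁺ʳ (if does (y ≟ x) then [ z ] else [])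
      (∈-++⁺ʳ (if does (z ≟ x) then [ y ] else []) (EdgeIn⇒∈-neighbours e))

  neighbours-∉ : ∀ {x} L → x ∉ L → neighbours L x ≡ []
  neighbours-∉ []           _ = refl
  neighbours-∉ (_ ∷ [])     _ = refl
  neighbours-∉ {x} (y ∷ z ∷ zs) x∉ with y ≟ x | z ≟ x | neighbours-∉ (z ∷ zs) (λ x∈ → x∉ (there x∈))
  ... | yes refl | _        | _  = ⊥-elim (x∉ (here refl))
  ... | no _     | yes refl | _  = ⊥-elim (x∉ (there (here refl)))
  ... | no _     | no _     | ih = ih

  length-neighbours-head : ∀ x zs → x ∉ zs → length (neighbours (x ∷ zs) x) ≤ 1
  length-neighbours-head x []       _  = z≤n
  length-neighbours-head x (z ∷ zs) x∉ with x ≟ x | z ≟ x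
  ... | no x≢x | _        = ⊥-elim (x≢x refl)
  ... | yes _  | yes refl = ⊥-elim (x∉ (here refl))
  ... | yes _  | no _     = s≤s (≤-reflexive (cong length (neighbours-∉ (z ∷ zs) x∉)))

  length-neighbours : ∀ {L} x → Unique L → length (neighbours L x) ≤ 2
  length-neighbours {[]}         x _ = z≤n
  length-neighbours {_ ∷ []}     x _ = z≤n
  length-neighbours {y ∷ z ∷ zs} x (y∉ ∷ z∉ ∷ u) with y ≟ x | z ≟ x | length-neighbours x (z∉ ∷ u)
  ... | yes refl | yes refl | _  = ⊥-elim (All.head y∉ refl)
  ... | yes refl | no _     | _  =
    s≤s (≤-trans (≤-reflexive (cong length (neighbours-∉ (z ∷ zs) (λ y∈ → All.lookup y∉ y∈ refl)))) z≤n)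
  ... | no _     | yes refl | _  = s≤s (length-neighbours-head z zs (λ z∈ → All.lookup z∉ z∈ refl))
  ... | no _     | no _     | ih = ih

  count-onWalk : ∀ {L} x → Unique L → count (onWalk L x) (allFin n) ≤ 2
  count-onWalk {L} x uniq = begin
    count (onWalk L x) (allFin n)
      ≤⟨ count-mono-⊆ _≟_ (onWalk L x) (allFin⁺ n) (λ _ e → EdgeIn⇒∈-neighbours (toWitness e)) ⟩
    count (onWalk L x) (neighbours L x)
      ≤⟨ count≤length (onWalk L x) (neighbours L x) ⟩
    length (neighbours L x)
      ≤⟨ length-neighbours x uniq ⟩
    2 ∎
    where open ≤-Reasoning

module _ {n : ℕ} where

  _⊆ᴱ_ : Graph n → Graph n → Set
  G ⊆ᴱ H = ∀ {x y} → Adj G x y → Adj H x y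

  degree-mono : ∀ {G H} → G ⊆ᴱ H → ∀ x → degree G x ≤ degree H x
  degree-mono G⊆H x = count-mono (λ y → G⊆H {x} {y}) (allFin n)

  _∖ₑ_ : Graph n → List (Fin n) → Graph n
  G ∖ₑ L = record
    { adj   = λ x y → adj G x y ∧ not (onWalk L x y)
    ; sym   = λ x y → cong₂ (λ p q → p ∧ not q) (Graph.sym G x y) (onWalk-sym L x y)
    ; irref = λ x → cong (_∧ not (onWalk L x x)) (irref G x)
    }

  Adj-∖ₑ⁻ : ∀ G L {x y} → Adj (G ∖ₑ L) x y → Adj G x y × ¬ EdgeIn L x y
  Adj-∖ₑ⁻ G L {x} {y} xy with Equivalence.to T-∧ xy
  ... | xy∈G , xy∉L = xy∈G , toWitnessFalse xy∉L

  HamPath-∖ₑ⁻ : ∀ {G L u v} → HamPath (G ∖ₑ L) u v → HamPath G u v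
  HamPath-∖ₑ⁻ {G} {L} P = record
    { verts  = verts P
    ; unique = unique P
    ; covers = covers P
    ; linked = Linked.map (proj₁ ∘ Adj-∖ₑ⁻ G L) (linked P)
    ; start  = start P
    ; end    = end P
    }

  HamPath-∖ₑ-avoids : ∀ {G L u v} (P : HamPath (G ∖ₑ L) u v) {a b} → EdgeIn (verts P) a b → ¬ EdgeIn L a b
  HamPath-∖ₑ-avoids {G} {L} P e = proj₂ (Adj-∖ₑ⁻ G L (Linked-edge (Adj-sym (G ∖ₑ L)) (linked P) e))

  degree-∖ₑ : ∀ G {L} x → Unique L → degree G x ≤ degree (G ∖ₑ L) x + 2
  degree-∖ₑ G {L} x uniq = begin
    degree G x
      ≤⟨ count-mono keep-or-drop (allFin n) ⟩
    count (λ y → adj (G ∖ₑ L) x y ∨ onWalk L x y) (allFin n)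
      ≤⟨ count-∨ (adj (G ∖ₑ L) x) (onWalk L x) (allFin n) ⟩
    degree (G ∖ₑ L) x + count (onWalk L x) (allFin n)
      ≤⟨ +-monoʳ-≤ (degree (G ∖ₑ L) x) (count-onWalk x uniq) ⟩
    degree (G ∖ₑ L) x + 2 ∎
    where
    open ≤-Reasoning
    keep-or-drop : ∀ y → T (adj G x y) → T (adj G x y ∧ not (onWalk L x y) ∨ onWalk L x y)
    keep-or-drop y _ with adj G x y | onWalk L x y
    ... | true | true  = tt
    ... | true | false = tt

  addEdge : ∀ (H : Graph n) {a b} → a ≢ b → Graph n
  addEdge H {a} {b} a≢b = record
    { adj   = λ x y → adj H x y ∨ onWalk (a ∷ b ∷ []) x y
    ; sym   = λ x y → cong₂ _∨_ (Graph.sym H x y) (onWalk-sym (a ∷ b ∷ []) x y)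
    ; irref = λ x → cong₂ _∨_ (irref H x) (Equivalence.to T-not-≡ (fromWitnessFalse (a≢b ∘ loop-ends)))
    }
    where
    loop-ends : ∀ {x} → EdgeIn (a ∷ b ∷ []) x x → a ≡ b
    loop-ends here-fwd = refl
    loop-ends here-bwd = refl
    loop-ends (there (there ()))

-- Bondy–Chvátal closure

module _ {A : Set} where

  Unique-++⁻ʳ : ∀ xs {ys : List A} → Unique (xs ++ ys) → Unique ys
  Unique-++⁻ʳ []       u       = u
  Unique-++⁻ʳ (x ∷ xs) (_ ∷ u) = Unique-++⁻ʳ xs u

  module _ {R E : A → A → Set} where

    data ∪-Split (xs : List A) : Set where
      only-R  : Linked R xs → ∪-Split xs
      first-E : ∀ α {x y} β → xs ≡ α ++ x ∷ y ∷ β → E x y →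
                Linked R (α ++ [ x ]) → Linked (R ∪ E) (y ∷ β) → ∪-Split xs

    ∪-split : ∀ {xs} → Linked (R ∪ E) xs → ∪-Split xs
    ∪-split []           = only-R []
    ∪-split [-]          = only-R [-]
    ∪-split (inj₂ e ∷ l) = first-E [] _ refl e [-] l
    ∪-split {w ∷ xs} (inj₁ r ∷ l) with ∪-split l
    ... | only-R l′ = only-R (r ∷ l′)
    ... | first-E α {x} β eq e lα lβ =
      first-E (w ∷ α) β (cong (w ∷_) eq) e
        (connected refl (trans (head-++-∷ α x [] _) (cong head (sym eq))) r Linked.∷′ lα) lβ

    Linked-∪-avoiding : ∀ c → (∀ {x y} → E x y → x ≡ c ⊎ y ≡ c) →
                        ∀ {xs} → c ∉ xs → Linked (R ∪ E) xs → Linked R xs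
    Linked-∪-avoiding c touches c∉ []           = []
    Linked-∪-avoiding c touches c∉ [-]          = [-]
    Linked-∪-avoiding c touches c∉ (inj₁ r ∷ l) = r ∷ Linked-∪-avoiding c touches (c∉ ∘ there) l
    Linked-∪-avoiding c touches c∉ (inj₂ e ∷ l) with touches e
    ... | inj₁ refl = ⊥-elim (c∉ (here refl))
    ... | inj₂ refl = ⊥-elim (c∉ (there (here refl)))

module _ {n : ℕ} (H : Graph n) {a b : Fin n} (a≢b : a ≢ b) where

  private
    ab : List (Fin n)
    ab = a ∷ b ∷ []

    touches-a : ∀ {x y} → EdgeIn ab x y → x ≡ a ⊎ y ≡ a
    touches-a here-fwd           = inj₁ refl
    touches-a here-bwd           = inj₂ refl
    touches-a (there (there ()))

    touches-b : ∀ {x y} → EdgeIn ab x y → x ≡ b ⊎ y ≡ b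
    touches-b here-fwd           = inj₂ refl
    touches-b here-bwd           = inj₁ refl
    touches-b (there (there ()))

  Adj-addEdge⁻ : ∀ {x y} → Adj (addEdge H a≢b) x y → (Adj H ∪ EdgeIn ab) x y
  Adj-addEdge⁻ xy = Sum.map₂ toWitness (Equivalence.to T-∨ xy)

  Adj-addEdge⁺ : H ⊆ᴱ addEdge H a≢b
  Adj-addEdge⁺ xy = Equivalence.from T-∨ (inj₁ xy)

  HamPath-addEdge⁻ : adj H a b ≡ false → n + 1 ≤ degree H a + degree H b →
                     ∀ {u v} → HamPath (addEdge H a≢b) u v → HamPath H u v
  HamPath-addEdge⁻ a≁b deg P =
    Rerouting⇒HamPath H (unique P) (covers P) (start P) (end P)
      (reroute-at (unique P) (covers P) (∪-split (Linked.map Adj-addEdge⁻ (linked P))))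
    where
    b≁a : adj H b a ≡ false
    b≁a = trans (Graph.sym H b a) a≁b
    deg′ : n + 1 ≤ degree H b + degree H a
    deg′ = subst (n + 1 ≤_) (+-comm (degree H a) (degree H b)) deg
    reroute-at : ∀ {L} → Unique L → (∀ z → z ∈ L) → ∪-Split L → Rerouting H L
    reroute-at {L} _ _ (only-R path) = L , ↭-refl , path , refl , refl
    reroute-at uniq cov (first-E α β refl here-fwd lα lβ) =
      reroute H a≁b deg α β uniq cov lα
        (Linked-∪-avoiding a touches-a (Unique[x∷xs]⇒x∉xs (Unique-++⁻ʳ α uniq)) lβ)
    reroute-at uniq cov (first-E α β refl here-bwd lα lβ) =
      reroute H b≁a deg′ α β uniq cov lα
        (Linked-∪-avoiding b touches-b (Unique[x∷xs]⇒x∉xs (Unique-++⁻ʳ α uniq)) lβ)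
    reroute-at _ _ (first-E α β refl (there (there ())) _ _)

module _ {n : ℕ} where

  HamiltonConnected : Graph n → Set
  HamiltonConnected H = ∀ u v → u ≢ v → HamPath H u v

  complete⇒HamiltonConnected : ∀ H → (∀ x y → x ≢ y → Adj H x y) → HamiltonConnected H
  complete⇒HamiltonConnected H complete u v u≢v = record
    { verts  = L
    ; unique = uniq
    ; covers = cover
    ; linked = Linked.map (λ {x} {y} → complete x y) (AllPairs⇒Linked uniq)
    ; start  = refl
    ; end    = last-++-∷ (u ∷ inner) v []
    }
    where
    inner? : ∀ z → Dec (u ≢ z × v ≢ z)
    inner? z = ¬? (u ≟ z) ×-dec ¬? (v ≟ z)
    inner : List (Fin n)
    inner = filter inner? (allFin n)
    L : List (Fin n)
    L = u ∷ inner ++ [ v ]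
    uniq : Unique L
    uniq = All.tabulate u≢ ∷ ++⁺ (Unique-filter⁺ inner? (allFin⁺ n)) (All.[] ∷ [])
      λ { (z∈ , here refl) → proj₂ (proj₂ (∈-filter⁻ inner? {xs = allFin n} z∈)) refl }
      where
      u≢ : ∀ {z} → z ∈ inner ++ [ v ] → u ≢ z
      u≢ z∈ with ∈-++⁻ inner z∈
      ... | inj₁ z∈inner  = proj₁ (proj₂ (∈-filter⁻ inner? {xs = allFin n} z∈inner))
      ... | inj₂ (here refl) = u≢v
    cover : ∀ z → z ∈ L
    cover z with u ≟ z | v ≟ z
    ... | yes refl | _        = here refl
    ... | no _     | yes refl = there (∈-++⁺ʳ inner (here refl))
    ... | no u≢z   | no v≢z   = there (∈-++⁺ˡ (∈-filter⁺ inner? (∈-allFin z) (u≢z , v≢z)))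

  record OrePair (H : Graph n) : Set where
    constructor orePair
    field
      {a b}      : Fin n
      a≢b        : a ≢ b
      a≁b        : adj H a b ≡ false
      degree-sum : n + 1 ≤ degree H a + degree H b

  count-≟≤1 : ∀ x → count (λ z → isYes (z ≟ x)) (allFin n) ≤ 1
  count-≟≤1 x =
    ≤-trans (count-mono-⊆ _≟_ (λ z → isYes (z ≟ x)) (allFin⁺ n) (λ _ z≡x → here (toWitness z≡x)))
            (count≤length (λ z → isYes (z ≟ x)) [ x ])

  NonEdge : Graph n → Fin n → Fin n → Set
  NonEdge H x y = x ≢ y × adj H x y ≡ false

  nonEdge? : ∀ H x y → Dec (NonEdge H x y)
  nonEdge? H x y = ¬? (x ≟ y) ×-dec (adj H x y ≟ᵇ false)

  ≢false⇒Adj : ∀ {H : Graph n} {x y} → adj H x y ≢ false → Adj H x y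
  ≢false⇒Adj x≁̸y = Equivalence.from T-≡ (¬-not x≁̸y)

  nonEdges : Graph n → ℕ
  nonEdges H = count (not ∘ uncurry (adj H)) (cartesianProduct (allFin n) (allFin n))

  nonEdges-addEdge : ∀ H {a b} (a≢b : a ≢ b) → adj H a b ≡ false → nonEdges (addEdge H a≢b) < nonEdges H
  nonEdges-addEdge H {a} {b} a≢b a≁b =
    count-mono-< still-non-edge (∈-cartesianProduct⁺ (∈-allFin a) (∈-allFin b))
      (subst (T ∘ not) (sym a≁b) tt)
      (λ t → subst T (Equivalence.to T-not-≡ t) (Equivalence.from T-∨ (inj₂ ab-on-walk)))
    where
    ab-on-walk : T (onWalk (a ∷ b ∷ []) a b)
    ab-on-walk = fromWitness here-fwd
    still-non-edge : ∀ xy → T (not (uncurry (adj (addEdge H a≢b)) xy)) → T (not (uncurry (adj H) xy))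
    still-non-edge (x , y) with adj H x y
    ... | true  = λ ()
    ... | false = λ _ → tt

-- The degree condition

private
  ore-sum-V₁ : ∀ {n p q} → n + 4 ≤ 2 * p + 2 → n + 4 ≤ 2 * q + 2 → n + 1 ≤ p + q
  ore-sum-V₁ {n} {p} {q} hp hq = ≤-trans (+-monoʳ-≤ n (n≤1+n 1))
    (*-cancelˡ-≤ 2 (+-cancelʳ-≤ 4 _ _ (subst₂ _≤_ (twice n) (sum p q) (+-mono-≤ hp hq))))
    where
    twice : ∀ n → (n + 4) + (n + 4) ≡ 2 * (n + 2) + 4
    twice = solve-∀
    sum : ∀ p q → (2 * p + 2) + (2 * q + 2) ≡ 2 * (p + q) + 4
    sum = solve-∀

  ore-sum-V₂ : ∀ {n v₁ v₂ p q} → v₁ + v₂ ≡ n → v₁ ≤ p + 1 → v₂ + 2 ≤ q → n + 1 ≤ p + q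
  ore-sum-V₂ {n} {v₁} {v₂} {p} {q} refl h₁ h₂ =
    +-cancelʳ-≤ 1 _ _ (subst₂ _≤_ (lhs v₁ v₂) (rhs p q) (+-mono-≤ h₁ h₂))
    where
    lhs : ∀ v₁ v₂ → v₁ + (v₂ + 2) ≡ v₁ + v₂ + 1 + 1
    lhs = solve-∀
    rhs : ∀ p q → p + 1 + q ≡ p + q + 1
    rhs = solve-∀

module _ {n : ℕ} (inV₁ : Fin n → Bool) where

  -- The bound n/2 + 2ℓ − 1 on V₁ is doubled to stay in ℕ.
  DegreeCondition : ℕ → Graph n → Set
  DegreeCondition ℓ G =
    (∀ x → inV₁ x ≡ true → n + 4 * ℓ ≤ 2 * degree G x + 2) ×
    (∀ x → inV₁ x ≡ false → countV (λ y → not (inV₁ y)) + 2 * ℓ ≤ degree G x)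

  DegreeCondition-⊆ᴱ : ∀ {ℓ G H} → G ⊆ᴱ H → DegreeCondition ℓ G → DegreeCondition ℓ H
  DegreeCondition-⊆ᴱ {G = G} {H = H} G⊆H (dc₁ , dc₂) =
    (λ x x∈V₁ → ≤-trans (dc₁ x x∈V₁) (+-monoˡ-≤ 2 (*-monoʳ-≤ 2 (degree-mono {G = G} {H = H} G⊆H x)))) ,
    (λ x x∈V₂ → ≤-trans (dc₂ x x∈V₂) (degree-mono {G = G} {H = H} G⊆H x))

  DegreeCondition-1 : ∀ {ℓ G} → DegreeCondition (suc ℓ) G → DegreeCondition 1 G
  DegreeCondition-1 {ℓ} (dc₁ , dc₂) =
    (λ x x∈V₁ → ≤-trans (+-monoʳ-≤ n (*-monoʳ-≤ 4 (s≤s (z≤n {ℓ})))) (dc₁ x x∈V₁)) ,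
    (λ x x∈V₂ → ≤-trans (+-monoʳ-≤ _ (*-monoʳ-≤ 2 (s≤s (z≤n {ℓ})))) (dc₂ x x∈V₂))

  DegreeCondition-∖ₑ : ∀ {ℓ G L} → Unique L → DegreeCondition (suc ℓ) G → DegreeCondition ℓ (G ∖ₑ L)
  DegreeCondition-∖ₑ {ℓ} {G} {L} uniq (dc₁ , dc₂) = V₁-bound , V₂-bound
    where
    open ≤-Reasoning
    V₁-bound : ∀ x → inV₁ x ≡ true → n + 4 * ℓ ≤ 2 * degree (G ∖ₑ L) x + 2
    V₁-bound x x∈V₁ = +-cancelʳ-≤ 4 _ _ (begin
      n + 4 * ℓ + 4                 ≡⟨ unfold-suc n ℓ ⟩
      n + 4 * suc ℓ                 ≤⟨ dc₁ x x∈V₁ ⟩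
      2 * degree G x + 2            ≤⟨ +-monoˡ-≤ 2 (*-monoʳ-≤ 2 (degree-∖ₑ G x uniq)) ⟩
      2 * (degree (G ∖ₑ L) x + 2) + 2 ≡⟨ shuffle (degree (G ∖ₑ L) x) ⟩
      2 * degree (G ∖ₑ L) x + 2 + 4 ∎)
      where
      unfold-suc : ∀ n ℓ → n + 4 * ℓ + 4 ≡ n + 4 * suc ℓ
      unfold-suc = solve-∀
      shuffle : ∀ d → 2 * (d + 2) + 2 ≡ 2 * d + 2 + 4
      shuffle = solve-∀
    V₂-bound : ∀ x → inV₁ x ≡ false → countV (λ y → not (inV₁ y)) + 2 * ℓ ≤ degree (G ∖ₑ L) x
    V₂-bound x x∈V₂ = +-cancelʳ-≤ 2 _ _ (begin
      countV (λ y → not (inV₁ y)) + 2 * ℓ + 2   ≡⟨ unfold-suc (countV (λ y → not (inV₁ y))) ℓ ⟩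
      countV (λ y → not (inV₁ y)) + 2 * suc ℓ   ≤⟨ dc₂ x x∈V₂ ⟩
      degree G x                                ≤⟨ degree-∖ₑ G x uniq ⟩
      degree (G ∖ₑ L) x + 2                     ∎)
      where
      unfold-suc : ∀ c ℓ → c + 2 * ℓ + 2 ≡ c + 2 * suc ℓ
      unfold-suc = solve-∀

  private
    V₁+V₂ : countV inV₁ + countV (λ y → not (inV₁ y)) ≡ n
    V₁+V₂ = trans (count-partition inV₁ (allFin n)) (length-tabulate id)

  -- A vertex adjacent to all of V₁ has at least |V₁| − 1 neighbours.
  dominates-V₁⇒degree-sum : ∀ {H x y} → DegreeCondition 1 H → inV₁ y ≡ false →
                            (∀ z → inV₁ z ≡ true → z ≢ x → Adj H x z) →
                            n + 1 ≤ degree H x + degree H y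
  dominates-V₁⇒degree-sum {H} {x} {y} (_ , dc₂) y∈V₂ dominates =
    ore-sum-V₂ V₁+V₂ V₁-bound (dc₂ y y∈V₂)
    where
    open ≤-Reasoning
    covered : ∀ z → T (inV₁ z) → T (isYes (z ≟ x) ∨ adj H x z)
    covered z z∈V₁ with z ≟ x
    ... | yes _  = tt
    ... | no z≢x = dominates z (Equivalence.to T-≡ z∈V₁) z≢x
    V₁-bound : countV inV₁ ≤ degree H x + 1
    V₁-bound = begin
      countV inV₁                                            ≤⟨ count-mono covered (allFin n) ⟩
      count (λ z → isYes (z ≟ x) ∨ adj H x z) (allFin n)     ≤⟨ count-∨ _ (adj H x) (allFin n) ⟩
      count (λ z → isYes (z ≟ x)) (allFin n) + degree H x    ≤⟨ +-monoˡ-≤ (degree H x) (count-≟≤1 x) ⟩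
      1 + degree H x                                         ≡⟨ +-comm 1 (degree H x) ⟩
      degree H x + 1                                         ∎

  -- Either two vertices of V₁ are non-adjacent, or some vertex dominates V₁ and is
  -- non-adjacent to a vertex of V₂.
  findOrePair : ∀ {H x₀ y₀} → DegreeCondition 1 H → NonEdge H x₀ y₀ → OrePair H
  findOrePair {H} {x₀} {y₀} dc@(dc₁ , _) (x₀≢y₀ , x₀≁y₀)
    with any? (λ x → any? (λ y → inV₁ x ≟ᵇ true ×-dec inV₁ y ≟ᵇ true ×-dec nonEdge? H x y))
  ... | yes (x , y , x∈V₁ , y∈V₁ , x≢y , x≁y) =
    orePair x≢y x≁y (ore-sum-V₁ {p = degree H x} {q = degree H y} (dc₁ x x∈V₁) (dc₁ y y∈V₁))
  ... | no ¬V₁V₁ with any? (λ x → any? (λ y → inV₁ x ≟ᵇ true ×-dec nonEdge? H x y))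
  ...   | yes (x , y , x∈V₁ , x≢y , x≁y) =
    orePair x≢y x≁y (dominates-V₁⇒degree-sum {H = H} dc (¬-not y∉V₁) x-dominates)
    where
    y∉V₁ : inV₁ y ≢ true
    y∉V₁ y∈V₁ = ¬V₁V₁ (x , y , x∈V₁ , y∈V₁ , x≢y , x≁y)
    x-dominates : ∀ z → inV₁ z ≡ true → z ≢ x → Adj H x z
    x-dominates z z∈V₁ z≢x =
      ≢false⇒Adj {H = H} λ x≁z → ¬V₁V₁ (x , z , x∈V₁ , z∈V₁ , z≢x ∘ sym , x≁z)
  ...   | no ¬V₁· =
    orePair x₀≢y₀ x₀≁y₀ (dominates-V₁⇒degree-sum {H = H} dc (¬-not y₀∉V₁) x₀-dominates)
    where
    y₀∉V₁ : inV₁ y₀ ≢ true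
    y₀∉V₁ y₀∈V₁ = ¬V₁· (y₀ , x₀ , y₀∈V₁ , x₀≢y₀ ∘ sym , trans (Graph.sym H y₀ x₀) x₀≁y₀)
    x₀-dominates : ∀ z → inV₁ z ≡ true → z ≢ x₀ → Adj H x₀ z
    x₀-dominates z z∈V₁ z≢x₀ =
      ≢false⇒Adj {H = H} λ x₀≁z → ¬V₁· (z , x₀ , z∈V₁ , z≢x₀ , trans (Graph.sym H z x₀) x₀≁z)

  DegreeCondition⇒HamiltonConnected : ∀ {H} → DegreeCondition 1 H → HamiltonConnected H
  DegreeCondition⇒HamiltonConnected {H} dc = go H dc (<-wellFounded (nonEdges H))
    where
    go : ∀ H → DegreeCondition 1 H → Acc _<_ (nonEdges H) → HamiltonConnected H
    go H dc (acc smaller) with any? (λ x → any? (λ y → nonEdge? H x y))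
    ... | no complete = complete⇒HamiltonConnected H λ x y x≢y →
                          ≢false⇒Adj {H = H} λ x≁y → complete (x , y , x≢y , x≁y)
    ... | yes (x , y , non-edge) with findOrePair {H = H} dc non-edge
    ...   | orePair a≢b a≁b degree-sum = λ u v u≢v →
      HamPath-addEdge⁻ H a≢b a≁b degree-sum
        (go (addEdge H a≢b) (DegreeCondition-⊆ᴱ {ℓ = 1} {G = H} {H = addEdge H a≢b} (Adj-addEdge⁺ H a≢b) dc)
            (smaller (nonEdges-addEdge H a≢b a≁b)) u v u≢v)

  edgeDisjointHamPaths : ∀ ℓ {G} → DegreeCondition ℓ G →
    (pairs : Fin ℓ → Fin n × Fin n) → (∀ i → proj₁ (pairs i) ≢ proj₂ (pairs i)) →
    Σ ((i : Fin ℓ) → HamPath G (proj₁ (pairs i)) (proj₂ (pairs i)))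
      (λ P → ∀ i j → i ≢ j → EdgeDisjoint (P i) (P j))
  edgeDisjointHamPaths zero    dc pairs distinct = (λ ()) , λ ()
  edgeDisjointHamPaths (suc ℓ) {G} dc pairs distinct = P , disjoint
    where
    P₀ : HamPath G (proj₁ (pairs zero)) (proj₂ (pairs zero))
    P₀ = DegreeCondition⇒HamiltonConnected (DegreeCondition-1 {ℓ = ℓ} {G = G} dc) _ _ (distinct zero)
    rest : Σ ((i : Fin ℓ) → HamPath (G ∖ₑ verts P₀) (proj₁ (pairs (suc i))) (proj₂ (pairs (suc i))))
             (λ Q → ∀ i j → i ≢ j → EdgeDisjoint (Q i) (Q j))
    rest = edgeDisjointHamPaths ℓ {G ∖ₑ verts P₀} (DegreeCondition-∖ₑ {ℓ = ℓ} {G = G} (unique P₀) dc)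
                                (pairs ∘ suc) (distinct ∘ suc)
    P : (i : Fin (suc ℓ)) → HamPath G (proj₁ (pairs i)) (proj₂ (pairs i))
    P zero    = P₀
    P (suc i) = HamPath-∖ₑ⁻ (proj₁ rest i)
    disjoint : ∀ i j → i ≢ j → EdgeDisjoint (P i) (P j)
    disjoint zero    zero    0≢0 = ⊥-elim (0≢0 refl)
    disjoint zero    (suc j) _   a b e₀ e = HamPath-∖ₑ-avoids {L = verts P₀} (proj₁ rest j) e e₀
    disjoint (suc i) zero    _   a b e e₀ = HamPath-∖ₑ-avoids {L = verts P₀} (proj₁ rest i) e e₀
    disjoint (suc i) (suc j) i≢j = proj₂ rest i j (i≢j ∘ cong suc)

lemma1 : (ℓ n : ℕ) → 1 ≤ ℓ → (G : Graph n) → (inV₁ : Fin n → Bool) →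
         ∃ (λ x → inV₁ x ≡ true) →
         (∀ x → inV₁ x ≡ true → n + 4 * ℓ ≤ 2 * degree G x + 2) →
         (∀ x → inV₁ x ≡ false → countV (λ y → not (inV₁ y)) + 2 * ℓ ≤ degree G x) →
         (pairs : Fin ℓ → Fin n × Fin n) →
         (∀ i → ¬ (proj₁ (pairs i) ≡ proj₂ (pairs i))) →
         Σ ((i : Fin ℓ) → HamPath G (proj₁ (pairs i)) (proj₂ (pairs i)))
           (λ P → ∀ i j → ¬ (i ≡ j) → EdgeDisjoint (P i) (P j))
lemma1 ℓ n _ G inV₁ _ V₁-degrees V₂-degrees =
  edgeDisjointHamPaths inV₁ ℓ (V₁-degrees , V₂-degrees)
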